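{- Let $\epsilon\ge0$, let $n_s,n_t$ be nodes, and let $\rho$ be a route from $n_s$ to a node $n_x$. If $L(\rho)+\mathit{fsL}[n_x]\le(1+\epsilon)\cdot\mathit{sfL}[n_s]$, then $\mathit{snfC}^+=C(\rho)+1+\mathit{fsC}[n_x]$ is an upper bound on the complexity of a simplest near-fastest route from $n_s$ to $n_t$.
   Context: Let $V$ be a finite set of nodes. A road is a finite sequence of distinct nodes of $V$. Let $R$ be a finite set of roads such that every node lies on at least one road and any pair of consecutive nodes of some road does not appear (as consecutive nodes) in any other road. For $n\in V$, $R(n)$ is the set of roads containing $n$. The road network is the directed graph $G_R=(V,E)$ with an edge $(n_i,n_j)$ whenever $n_i,n_j$ are consecutive nodes of some road; $R(n_i,n_j)$ denotes the unique road containing this segment. A length function $L:E\to\mathbb{R}^+$ is given; the turn cost is $C(n,r,r')=1$ if $r\neq r'$ and $0$ if $r=r'$. A route is a node sequence $(n_1,\dots,n_k)$ with consecutive nodes joined by edges (nodes may repeat); its length $L(\cdot)$ is the sum of its edge lengths and its complexity is $C(\cdot)=\sum_{m=2}^{k-1}C(n_m,R(n_{m-1},n_m),R(n_m,n_{m+1}))$. A fastest route from $a$ to $b$ has minimum length; a simplest route has minimum complexity; a fastest simplest route has minimum length among simplest routes; a simplest fastest route has minimum complexity among fastest routes. A route from $n_s$ to $n_t$ is near-fastest if its length is at most $(1+\epsilon)$ times the minimum length of a route from $n_s$ to $n_t$; a simplest near-fastest route has minimum complexity among near-fastest routes from $n_s$ to $n_t$. For each node $n$: $\mathit{sfL}[n]$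 is the length of a simplest fastest route from $n$ to $n_t$ (the minimum length of a route from $n$ to $n_t$); $\mathit{fsL}[n]$ and $\mathit{fsC}[n]$ are the length and complexity of a fastest simplest route from $n$ to $n_t$.
   Formalization: The length function $L$ takes positive rational values instead of values in $\mathbb{R}^+$, and the parameter $\epsilon$ is rational. -}

module Defs where

open import Data.Nat as ℕ using (ℕ; zero; suc)
open import Data.Fin using (Fin; _≟_)
open import Data.List using (List; []; _∷_)
open import Data.List.Relation.Unary.Unique.Propositional using (Unique)
open import Data.List.Membership.Propositional using (_∈_)
open import Data.Maybe using (Maybe; just; nothing)
open import Data.Rational using (ℚ; 0ℚ; 1ℚ; _+_; _*_; _≤_; _<_)
open import Data.Product using (Σ; ∃; _×_)
open import Relation.Binary.PropositionalEquality using (_≡_)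
open import Relation.Nullary using (yes; no)

data Consec {A : Set} (u v : A) : List A → Set where
  here  : ∀ {xs} → Consec u v (u ∷ v ∷ xs)
  there : ∀ {x xs} → Consec u v xs → Consec u v (x ∷ xs)

-- A road network on nodes V = Fin nV with a finite set of roads indexed by Fin k,
-- together with a length function (only its values on edges matter).
record RoadNetwork (nV k : ℕ) : Set where
  field
    road      : Fin k → List (Fin nV)
    distinct  : ∀ r → Unique (road r)
    covers    : ∀ (n : Fin nV) → ∃ λ r → n ∈ road r
    segUnique : ∀ r r' u v → Consec u v (road r) → Consec u v (road r') → r ≡ r'
    len       : Fin nV → Fin nV → ℚ
    lenPos    : ∀ r u v → Consec u v (road r) → 0ℚ < len u v

module _ {nV k : ℕ} (N : RoadNetwork nV k) where
  open RoadNetwork N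

  -- A route (n_1,...,n_m), m ≥ 1, from a to b; each step u → v carries the
  -- (unique, by segUnique) road R(u,v) containing the segment.
  data Route : Fin nV → Fin nV → Set where
    stop : ∀ n → Route n n
    step : ∀ {u v w} (r : Fin k) → Consec u v (road r) → Route v w → Route u w

  lengthR : ∀ {a b} → Route a b → ℚ
  lengthR (stop _) = 0ℚ
  lengthR (step {u} {v} _ _ ρ) = len u v + lengthR ρ

  turn : Fin k → Fin k → ℕ
  turn r r' with r ≟ r'
  ... | yes _ = 0
  ... | no  _ = 1

  cplx : ∀ {a b} → Maybe (Fin k) → Route a b → ℕ
  cplx _          (stop _)       = 0
  cplx nothing    (step r _ ρ)   = cplx (just r) ρ
  cplx (just r₀)  (step r _ ρ)   = turn r₀ r ℕ.+ cplx (just r) ρ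

  complexity : ∀ {a b} → Route a b → ℕ
  complexity = cplx nothing

  IsFastest : ∀ {a b} → Route a b → Set
  IsFastest {a} {b} ρ = ∀ (σ : Route a b) → lengthR ρ ≤ lengthR σ

  IsSimplest : ∀ {a b} → Route a b → Set
  IsSimplest {a} {b} ρ = ∀ (σ : Route a b) → complexity ρ ℕ.≤ complexity σ

  IsFastestSimplest : ∀ {a b} → Route a b → Set
  IsFastestSimplest {a} {b} ρ =
    IsSimplest ρ × (∀ (σ : Route a b) → IsSimplest σ → lengthR ρ ≤ lengthR σ)

  IsNearFastest : ℚ → ∀ {a b} → Route a b → Set
  IsNearFastest ε {a} {b} ρ =
    Σ (Route a b) λ φ → IsFastest φ × (lengthR ρ ≤ (1ℚ + ε) * lengthR φ)

  IsSimplestNearFastest : ℚ → ∀ {a b} → Route a b → Set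
  IsSimplestNearFastest ε {a} {b} ρ =
    IsNearFastest ε ρ × (∀ (σ : Route a b) → IsNearFastest ε σ → complexity ρ ℕ.≤ complexity σ)

{-# OPTIONS --safe #-}
-- Appending a fastest simplest route τ from nₓ to the given route ρ yields a route
-- from nₛ to nₜ whose length L(ρ) + L(τ) is near-fastest by hypothesis, so a simplest
-- near-fastest route is at most as complex. Concatenation costs at most one extra
-- turn, at the junction nₓ.
module Submission where

open import Defs
open import Data.Nat using (ℕ; _≤_; _+_; z≤n; s≤s)
open import Data.Nat.Properties using (≤-trans; n≤1+n; +-monoˡ-≤; +-monoʳ-≤; +-assoc; module ≤-Reasoning)
open import Data.Fin using (Fin; _≟_)
open import Data.Maybe using (Maybe; just; nothing)
open import Data.Product using (_,_)
open import Relation.Nullary using (yes; no)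
open import Relation.Binary.PropositionalEquality using (_≡_; cong; sym; trans)
open import Data.Rational using (ℚ; 0ℚ; 1ℚ) renaming (_+_ to _+ℚ_; _*_ to _*ℚ_; _≤_ to _≤ℚ_)
import Data.Rational.Properties as ℚ

module _ {nV k : ℕ} {N : RoadNetwork nV k} where
  open RoadNetwork N

  infixr 5 _++ᴿ_

  _++ᴿ_ : ∀ {a b c} → Route N a b → Route N b c → Route N a c
  stop _       ++ᴿ τ = τ
  step r c ρ   ++ᴿ τ = step r c (ρ ++ᴿ τ)

  lengthR-++ᴿ : ∀ {a b c} (ρ : Route N a b) (τ : Route N b c) →
    lengthR N (ρ ++ᴿ τ) ≡ lengthR N ρ +ℚ lengthR N τ
  lengthR-++ᴿ (stop _) τ = sym (ℚ.+-identityˡ (lengthR N τ))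
  lengthR-++ᴿ (step {u} {v} _ _ ρ) τ =
    trans (cong (len u v +ℚ_) (lengthR-++ᴿ ρ τ))
          (sym (ℚ.+-assoc (len u v) (lengthR N ρ) (lengthR N τ)))

  ++ᴿ-isNearFastest : ∀ ε {a b c} (ρ : Route N a b) (τ : Route N b c) →
    (φ : Route N a c) → IsFastest N φ →
    lengthR N ρ +ℚ lengthR N τ ≤ℚ (1ℚ +ℚ ε) *ℚ lengthR N φ →
    IsNearFastest N ε (ρ ++ᴿ τ)
  ++ᴿ-isNearFastest ε ρ τ φ φ-fastest ρτ≤ =
    φ , φ-fastest , ℚ.≤-trans (ℚ.≤-reflexive (lengthR-++ᴿ ρ τ)) ρτ≤

  turn≤1 : ∀ r r' → turn N r r' ≤ 1
  turn≤1 r r' with r ≟ r'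
  ... | yes _ = z≤n
  ... | no  _ = s≤s z≤n

  cplx≤1+complexity : ∀ {a b} (prev : Maybe (Fin k)) (τ : Route N a b) →
    cplx N prev τ ≤ 1 + complexity N τ
  cplx≤1+complexity _         (stop _)     = z≤n
  cplx≤1+complexity nothing   (step _ _ τ) = n≤1+n _
  cplx≤1+complexity (just r₀) (step r _ τ) = +-monoˡ-≤ (cplx N (just r) τ) (turn≤1 r₀ r)

  cplx-++ᴿ : ∀ {a b c} (prev : Maybe (Fin k)) (ρ : Route N a b) (τ : Route N b c) →
    cplx N prev (ρ ++ᴿ τ) ≤ cplx N prev ρ + 1 + complexity N τ
  cplx-++ᴿ prev      (stop _)     τ = cplx≤1+complexity prev τ
  cplx-++ᴿ nothing   (step r _ ρ) τ = cplx-++ᴿ (just r) ρ τ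
  cplx-++ᴿ (just r₀) (step r _ ρ) τ = begin
    t + cplx N (just r) (ρ ++ᴿ τ)   ≤⟨ +-monoʳ-≤ t (cplx-++ᴿ (just r) ρ τ) ⟩
    t + (cρ + 1 + cτ)               ≡⟨ sym (+-assoc t (cρ + 1) cτ) ⟩
    t + (cρ + 1) + cτ               ≡⟨ cong (_+ cτ) (sym (+-assoc t cρ 1)) ⟩
    t + cρ + 1 + cτ                 ∎
    where
      open ≤-Reasoning
      t  = turn N r₀ r
      cρ = cplx N (just r) ρ
      cτ = complexity N τ

lemma6 : ∀ {nV k : ℕ} (N : RoadNetwork nV k) (ε : ℚ) → 0ℚ ≤ℚ ε →
    (nₛ nₜ nₓ : Fin nV) (ρ : Route N nₛ nₓ) →
    -- φ : a fastest route from nₛ to nₜ, so sfL[nₛ] = lengthR φ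
    (φ : Route N nₛ nₜ) → IsFastest N φ →
    -- τ : a fastest simplest route from nₓ to nₜ, so fsL[nₓ] = lengthR τ, fsC[nₓ] = complexity τ
    (τ : Route N nₓ nₜ) → IsFastestSimplest N τ →
    lengthR N ρ +ℚ lengthR N τ ≤ℚ (1ℚ +ℚ ε) *ℚ lengthR N φ →
    ∀ (σ : Route N nₛ nₜ) → IsSimplestNearFastest N ε σ →
    complexity N σ ≤ complexity N ρ + 1 + complexity N τ
lemma6 N ε _ nₛ nₜ nₓ ρ φ φ-fastest τ _ ρτ≤ σ (_ , σ-simplest) =
  ≤-trans (σ-simplest (ρ ++ᴿ τ) (++ᴿ-isNearFastest ε ρ τ φ φ-fastest ρτ≤))
          (cplx-++ᴿ nothing ρ τ)
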